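{- Let $H=(V,\mathcal{E})$ be a hypergraph with $V$ finite. Let $\mathcal{E}_0=\mathcal{E}$, $\mathcal{E}_{i+1}=\min\epsilon(\mathcal{E}_i)$ for $i\in\mathbb{N}$, and $\mathcal{E}'=\min\big(\bigcup_i\mathcal{E}_i\big)$. Moreover let $\mathcal{F}_0=\mathcal{E}$, $\mathcal{F}_{i+1}={\uparrow}\epsilon(\mathcal{F}_i)$ for $i\in\mathbb{N}$, and $\mathcal{F}=\bigcup_i\mathcal{F}_i$. Then $\min\mathcal{F}=\mathcal{E}'$, and $(V,\mathcal{E}')$ is a matroid.
   Context: A hypergraph is a pair $(V,\mathcal{E})$ with $\mathcal{E}\subseteq\mathcal{P}(V)$; it is simple if there are no two distinct edges $e,f$ with $e\subseteq f$. A simple hypergraph $(V,\mathcal{E})$ is called a matroid (identified with its set of circuits $\mathcal{E}$) if for all $C_1\neq C_2$ in $\mathcal{E}$ and every $v\in C_1\cap C_2$ there is $C_3\in\mathcal{E}$ with $C_3\subseteq (C_1\cup C_2)\setminus\{v\}$. For a family $\mathcal{X}\subseteq\mathcal{P}(V)$: $\epsilon(\mathcal{X})=\mathcal{X}\cup\{(A_1\cup A_2)\setminus\{v\}: A_1,A_2\in\mathcal{X},\ A_1\cap A_2\notin\mathcal{X},\ v\in A_1\cap A_2\}$; $\min\mathcal{X}=\{A\in\mathcal{X}: \text{there is no } A'\in\mathcal{X} \text{ with } A'\subsetneq A\}$; ${\uparrow}\mathcal{X}=\{A\subseteq V: \exists A'\in\mathcal{X},\ A'\subseteq A\}$ (upward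 closure). The hypergraph $(V,\mathcal{E}')$ is called the matroidal closure $\overline{H}$ of $H$. -}

module Defs where

open import Data.Nat using (ℕ; zero; suc)
open import Data.Fin using (Fin)
open import Data.Fin.Subset using (Subset; _∪_; _∩_; _-_; _⊆_; _⊂_; _∈_)
open import Data.List using (List)
open import Data.List.Relation.Unary.Any using (Any)
open import Data.Product using (Σ; ∃; _×_)
open import Relation.Binary.PropositionalEquality using (_≡_; _≢_)
open import Relation.Nullary using (¬_)
open import Function.Bundles using (_⇔_)

Family : ℕ → Set₁
Family n = Subset n → Set

-- A hypergraph on V = Fin n: its (finitely many) edges given as a list.
-- The associated family: A is an edge iff A occurs in the list.
edgesOf : ∀ {n} → List (Subset n) → Family n
edgesOf ℰ A = Any (A ≡_) ℰ

ε : ∀ {n} → Family n → Family n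
ε {n} X A = X A ⊎' (Σ (Subset n) λ A₁ → Σ (Subset n) λ A₂ → Σ (Fin n) λ v →
              X A₁ × X A₂ × ¬ X (A₁ ∩ A₂) × v ∈ (A₁ ∩ A₂) × A ≡ ((A₁ ∪ A₂) - v))
  where
  open import Data.Sum using () renaming (_⊎_ to _⊎'_)

minF : ∀ {n} → Family n → Family n
minF {n} X A = X A × ((A' : Subset n) → X A' → ¬ (A' ⊂ A))

up : ∀ {n} → Family n → Family n
up {n} X A = Σ (Subset n) λ A' → X A' × A' ⊆ A

bigUnion : ∀ {n} → (ℕ → Family n) → Family n
bigUnion X A = ∃ λ i → X i A

Eseq : ∀ {n} → Family n → ℕ → Family n
Eseq ℰ zero    = ℰ
Eseq ℰ (suc i) = minF (ε (Eseq ℰ i))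

E' : ∀ {n} → Family n → Family n
E' ℰ = minF (bigUnion (Eseq ℰ))

Fseq : ∀ {n} → Family n → ℕ → Family n
Fseq ℰ zero    = ℰ
Fseq ℰ (suc i) = up (ε (Fseq ℰ i))

Fam : ∀ {n} → Family n → Family n
Fam ℰ = bigUnion (Fseq ℰ)

_≐_ : ∀ {n} → Family n → Family n → Set
_≐_ {n} X Y = (A : Subset n) → X A ⇔ Y A

IsSimple : ∀ {n} → Family n → Set
IsSimple {n} X = (e f : Subset n) → X e → X f → e ≢ f → ¬ (e ⊆ f)

IsMatroid : ∀ {n} → Family n → Set
IsMatroid {n} X = IsSimple X ×
  ((C₁ C₂ : Subset n) → X C₁ → X C₂ → C₁ ≢ C₂ → (v : Fin n) → v ∈ (C₁ ∩ C₂) →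
     Σ (Subset n) λ C₃ → X C₃ × C₃ ⊆ ((C₁ ∪ C₂) - v))

-- Both sequences move in lock step: by induction, ℰᵢ ⊆ ℱᵢ ⊆ ↑ℰᵢ.  For i ≥ 1, ℰᵢ is an
-- antichain and ℱᵢ is upward closed, and then every elimination (A₁ ∪ A₂) ∖ {v} performed in
-- ℱᵢ lies above one performed on members of ℰᵢ below A₁ and A₂, while every elimination
-- performed in ℰᵢ is also one performed in ℱᵢ.  So ⋃ℰᵢ ⊆ ℱ ⊆ ↑⋃ℰᵢ, whence min ℱ = ℰ'.
-- The ℱᵢ form an increasing chain of families of subsets of a finite set, so they stabilise
-- (a strict step adds a set, and there are only 2ⁿ); hence ℱ is decidable.  Being the union of
-- an increasing chain, ℱ is closed under elimination, and so its minimal members satisfy the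
-- circuit axioms.
module Submission where

open import Defs
open import Data.Nat using (ℕ; zero; suc; _+_; _⊔_; _≤_; _<_; _^_; _≤′_; ≤′-refl; ≤′-step; z≤n; s≤s)
open import Data.Nat.Properties
  using (≤-refl; ≤-trans; +-mono-≤; +-mono-<-≤; +-mono-≤-<; n≮n; m≤m+n; m≤n+m; m≤m⊔n; m≤n⊔m; ≤⇒≤′)
open import Data.Fin using (Fin; zero; suc)
open import Data.Fin.Subset using (Subset; _∪_; _∩_; _-_; _─_; _⊆_; _⊂_; _∈_; _∉_; inside; outside)
open import Data.Fin.Subset.Properties
  using (_⊆?_; _⊂?_; _∈?_; anySubset?; ⊆-refl; ⊆-trans; ⊆-antisym; ⊆-⊂-trans; p∩q⊆p; p∩q⊆q;
         x∈p∩q⁺; x∈p∩q⁻; p⊆p∪q; q⊆p∪q; x∈p∪q⁻; x∈p∪q⁺; x∈p∧x≢y⇒x∈p-y; p─q⊆p; x∈⁅x⁆)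
open import Data.Fin.Subset.Induction using (Acc; acc; ⊂-wellFounded)
open import Data.Fin.Properties using (any?)
open import Data.Bool.Properties using () renaming (_≟_ to _≟ᵇ_)
open import Data.Vec.Base using ([]; _∷_; there)
open import Data.Vec.Properties using (≡-dec)
open import Data.List using (List)
open import Data.List.Relation.Unary.Any using () renaming (any? to anyᴸ?)
open import Data.Product using (∃; _×_; _,_; proj₁; proj₂)
open import Data.Sum using (_⊎_; inj₁; inj₂)
open import Relation.Binary.PropositionalEquality using (_≡_; _≢_; refl; sym; subst)
open import Relation.Nullary using (¬_; Dec; yes; no; contradiction)
open import Relation.Nullary.Decidable using (_×-dec_; _⊎-dec_; ¬?; decidable-stable)
open import Function.Bundles using (mk⇔; Equivalence)

private
  variable
    n : ℕ
    X Y : Family n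

infix 4 _≟ˢ_
_≟ˢ_ : (p q : Subset n) → Dec (p ≡ q)
_≟ˢ_ = ≡-dec _≟ᵇ_

x∈p─q⇒x∉q : {x : Fin n} (p q : Subset n) → x ∈ p ─ q → x ∉ q
x∈p─q⇒x∉q {x = zero}  (_ ∷ p) (inside  ∷ q) ()        _
x∈p─q⇒x∉q {x = suc x} (_ ∷ p) (_       ∷ q) (there h) (there h′) = x∈p─q⇒x∉q p q h h′

x∈p-y⇒x≢y : {x y : Fin n} (p : Subset n) → x ∈ p - y → x ≢ y
x∈p-y⇒x≢y {y = y} p h refl = x∈p─q⇒x∉q p _ h (x∈⁅x⁆ y)

p⊆q⇒p-x⊆q-x : {p q : Subset n} (x : Fin n) → p ⊆ q → p - x ⊆ q - x
p⊆q⇒p-x⊆q-x {p = p} x p⊆q h = x∈p∧x≢y⇒x∈p-y (p⊆q (p─q⊆p p _ h)) (x∈p-y⇒x≢y p h)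

x∉p∧p⊆q⇒p⊆q-x : {p q : Subset n} (x : Fin n) → x ∉ p → p ⊆ q → p ⊆ q - x
x∉p∧p⊆q⇒p⊆q-x x x∉p p⊆q h = x∈p∧x≢y⇒x∈p-y (p⊆q h) (λ { refl → x∉p h })

p⊆q∧p≢q⇒p⊂q : {p q : Subset n} → p ⊆ q → p ≢ q → p ⊂ q
p⊆q∧p≢q⇒p⊂q {p = p} {q} p⊆q p≢q with any? (λ x → x ∈? q ×-dec ¬? (x ∈? p))
... | yes new = p⊆q , new
... | no none = contradiction (⊆-antisym p⊆q q⊆p) p≢q
  where
  q⊆p : q ⊆ p
  q⊆p {x} x∈q = decidable-stable (x ∈? p) (λ x∉p → none (x , x∈q , x∉p))

DecFamily : Family n → Set
DecFamily {n} X = (A : Subset n) → Dec (X A)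

infix 4 _⊑_
_⊑_ : Family n → Family n → Set
_⊑_ {n} X Y = (A : Subset n) → X A → Y A

Antichain : Family n → Set
Antichain {n} X = (A B : Subset n) → X A → X B → A ⊆ B → A ≡ B

UpwardClosed : Family n → Set
UpwardClosed {n} X = (A B : Subset n) → X A → A ⊆ B → X B

edgesOf-dec : (ℰ : List (Subset n)) → DecFamily (edgesOf ℰ)
edgesOf-dec ℰ A = anyᴸ? (A ≟ˢ_) ℰ

ε-dec : DecFamily X → DecFamily (ε X)
ε-dec X? A = X? A ⊎-dec
  anySubset? λ A₁ → anySubset? λ A₂ → any? λ v →
    X? A₁ ×-dec X? A₂ ×-dec ¬? (X? (A₁ ∩ A₂)) ×-dec v ∈? A₁ ∩ A₂ ×-dec A ≟ˢ (A₁ ∪ A₂) - v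

minF-dec : DecFamily X → DecFamily (minF X)
minF-dec X? A with X? A | anySubset? (λ A′ → X? A′ ×-dec A′ ⊂? A)
... | no ¬XA | _                      = no (λ m → ¬XA (proj₁ m))
... | yes _  | yes (A′ , XA′ , A′⊂A) = no (λ m → proj₂ m A′ XA′ A′⊂A)
... | yes XA | no none                = yes (XA , λ A′ XA′ A′⊂A → none (A′ , XA′ , A′⊂A))

up-dec : DecFamily X → DecFamily (up X)
up-dec X? A = anySubset? (λ A′ → X? A′ ×-dec A′ ⊆? A)

minF-below-acc : DecFamily X → (A : Subset n) → Acc _⊂_ A → X A →
                 ∃ λ B → minF X B × B ⊆ A
minF-below-acc X? A (acc rs) XA with anySubset? (λ A′ → X? A′ ×-dec A′ ⊂? A)
... | no none = A , (XA , λ A′ XA′ A′⊂A → none (A′ , XA′ , A′⊂A)) , ⊆-refl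
... | yes (A′ , XA′ , A′⊂A) with minF-below-acc X? A′ (rs A′⊂A) XA′
...   | B , minB , B⊆A′ = B , minB , ⊆-trans B⊆A′ (proj₁ A′⊂A)

minF-below : DecFamily X → (A : Subset n) → X A → ∃ λ B → minF X B × B ⊆ A
minF-below X? A = minF-below-acc X? A (⊂-wellFounded A)

⊑-refl : X ⊑ X
⊑-refl A XA = XA

minF⊑ : minF X ⊑ X
minF⊑ A = proj₁

⊑up : X ⊑ up X
⊑up A XA = A , XA , ⊆-refl

up-mono : X ⊑ Y → up X ⊑ up Y
up-mono X⊑Y A (B , XB , B⊆A) = B , X⊑Y B XB , B⊆A

up-idem : up (up X) ⊑ up X
up-idem A (B , (C , XC , C⊆B) , B⊆A) = C , XC , ⊆-trans C⊆B B⊆A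

up⊑up-minF : DecFamily X → up X ⊑ up (minF X)
up⊑up-minF X? A (B , XB , B⊆A) with minF-below X? B XB
... | C , minC , C⊆B = C , minC , ⊆-trans C⊆B B⊆A

minF-antichain : (X : Family n) → Antichain (minF X)
minF-antichain X A B (XA , _) (_ , minB) A⊆B with A ≟ˢ B
... | yes A≡B = A≡B
... | no A≢B  = contradiction (p⊆q∧p≢q⇒p⊂q A⊆B A≢B) (minB A XA)

up-upwardClosed : (X : Family n) → UpwardClosed (up X)
up-upwardClosed X A B (C , XC , C⊆A) A⊆B = C , XC , ⊆-trans C⊆A A⊆B

ε-resp : X ⊑ Y → Y ⊑ X → ε X ⊑ ε Y
ε-resp X⊑Y Y⊑X A (inj₁ XA) = inj₁ (X⊑Y A XA)
ε-resp X⊑Y Y⊑X A (inj₂ (A₁ , A₂ , v , XA₁ , XA₂ , ¬X∩ , v∈ , A≡)) =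
  inj₂ (A₁ , A₂ , v , X⊑Y A₁ XA₁ , X⊑Y A₂ XA₂ , (λ Y∩ → ¬X∩ (Y⊑X _ Y∩)) , v∈ , A≡)

-- Equivalently: X ⊆ Y and ↑X = ↑Y.
Between : Family n → Family n → Set
Between X Y = X ⊑ Y × Y ⊑ up X

between-refl : Between X X
between-refl = ⊑-refl , ⊑up

between⇒minF≐ : Between X Y → minF Y ≐ minF X
between⇒minF≐ {X = X} {Y = Y} (X⊑Y , Y⊑↑X) A = mk⇔ to from
  where
  to : minF Y A → minF X A
  to (YA , minA) with Y⊑↑X A YA
  ... | B , XB , B⊆A with B ≟ˢ A
  ...   | yes refl = XB , λ A′ XA′ → minA A′ (X⊑Y A′ XA′)
  ...   | no B≢A   = contradiction (p⊆q∧p≢q⇒p⊂q B⊆A B≢A) (minA B (X⊑Y B XB))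
  from : minF X A → minF Y A
  from (XA , minA) = X⊑Y A XA , λ A′ YA′ A′⊂A →
    let B , XB , B⊆A′ = Y⊑↑X A′ YA′ in minA B XB (⊆-⊂-trans B⊆A′ A′⊂A)

between-minF-up : DecFamily X → Between X Y → Between (minF X) (up Y)
between-minF-up X? (X⊑Y , Y⊑↑X) =
  (λ A minA → ⊑up A (X⊑Y A (minF⊑ A minA))) ,
  (λ A ↑YA → up⊑up-minF X? A (up-idem A (up-mono Y⊑↑X A ↑YA)))

module _ (X-antichain : Antichain X) (Y-closed : UpwardClosed Y) (X⊑Y : X ⊑ Y) (Y⊑↑X : Y ⊑ up X) where

  private
    ↑X-below-member : ∀ {A B} → up X A → X B → A ⊆ B → X A
    ↑X-below-member {A} {B} (C , XC , C⊆A) XB A⊆B with X-antichain C B XC XB (⊆-trans C⊆A A⊆B)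
    ... | refl = subst X (⊆-antisym C⊆A A⊆B) XC

  ε-mono-between : ε X ⊑ ε Y
  ε-mono-between A (inj₁ XA) = inj₁ (X⊑Y A XA)
  ε-mono-between A (inj₂ (B₁ , B₂ , v , XB₁ , XB₂ , ¬X∩ , v∈ , A≡)) =
    inj₂ (B₁ , B₂ , v , X⊑Y B₁ XB₁ , X⊑Y B₂ XB₂ , ¬Y∩ , v∈ , A≡)
    where
    ¬Y∩ : ¬ Y (B₁ ∩ B₂)
    ¬Y∩ Y∩ = ¬X∩ (↑X-below-member (Y⊑↑X _ Y∩) XB₁ (p∩q⊆p B₁ B₂))

  ε-up-between : ε Y ⊑ up (ε X)
  ε-up-between A (inj₁ YA) = up-mono (λ B → inj₁) A (Y⊑↑X A YA)
  ε-up-between _ (inj₂ (A₁ , A₂ , v , YA₁ , YA₂ , ¬Y∩ , v∈ , refl))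
    with Y⊑↑X A₁ YA₁ | Y⊑↑X A₂ YA₂
  ... | B₁ , XB₁ , B₁⊆A₁ | B₂ , XB₂ , B₂⊆A₂ with v ∈? B₁ | v ∈? B₂
  ...   | no v∉B₁ | _       = B₁ , inj₁ XB₁ , x∉p∧p⊆q⇒p⊆q-x v v∉B₁ (⊆-trans B₁⊆A₁ (p⊆p∪q A₂))
  ...   | yes _   | no v∉B₂ = B₂ , inj₁ XB₂ , x∉p∧p⊆q⇒p⊆q-x v v∉B₂ (⊆-trans B₂⊆A₂ (q⊆p∪q A₁ A₂))
  ...   | yes v∈B₁ | yes v∈B₂ =
    (B₁ ∪ B₂) - v , inj₂ (B₁ , B₂ , v , XB₁ , XB₂ , ¬X∩ , x∈p∩q⁺ (v∈B₁ , v∈B₂) , refl) ,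
    p⊆q⇒p-x⊆q-x v ∪-mono
    where
    ¬X∩ : ¬ X (B₁ ∩ B₂)
    ¬X∩ X∩ = ¬Y∩ (Y-closed _ _ (X⊑Y _ X∩) λ h →
      let x∈B₁ , x∈B₂ = x∈p∩q⁻ B₁ B₂ h in x∈p∩q⁺ (B₁⊆A₁ x∈B₁ , B₂⊆A₂ x∈B₂))
    ∪-mono : B₁ ∪ B₂ ⊆ A₁ ∪ A₂
    ∪-mono h with x∈p∪q⁻ B₁ B₂ h
    ... | inj₁ x∈B₁ = x∈p∪q⁺ (inj₁ (B₁⊆A₁ x∈B₁))
    ... | inj₂ x∈B₂ = x∈p∪q⁺ (inj₂ (B₂⊆A₂ x∈B₂))

between-ε : Antichain X → UpwardClosed Y → Between X Y → Between (ε X) (ε Y)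
between-ε X-antichain Y-closed (X⊑Y , Y⊑↑X) =
  ε-mono-between X-antichain Y-closed X⊑Y Y⊑↑X , ε-up-between X-antichain Y-closed X⊑Y Y⊑↑X

indicator : {A : Set} → Dec A → ℕ
indicator (yes _) = 1
indicator (no _)  = 0

count : ∀ {n} {X : Family n} → DecFamily X → ℕ
count {n = zero}          X? = indicator (X? [])
count {n = suc n} {X = X} X? = count {X = λ A → X (inside ∷ A)} (λ A → X? (inside ∷ A))
                             + count {X = λ A → X (outside ∷ A)} (λ A → X? (outside ∷ A))

count≤2^n : ∀ {n} {X : Family n} (X? : DecFamily X) → count X? ≤ 2 ^ n
count≤2^n {n = zero}  X? with X? []
... | yes _ = ≤-refl
... | no _  = z≤n
count≤2^n {n = suc n} X? =
  +-mono-≤ (count≤2^n (λ A → X? (inside ∷ A)))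
           (≤-trans (count≤2^n (λ A → X? (outside ∷ A))) (m≤m+n (2 ^ n) 0))

count-mono : ∀ {n} {X Y : Family n} (X? : DecFamily X) (Y? : DecFamily Y) → X ⊑ Y → count X? ≤ count Y?
count-mono {n = zero} X? Y? X⊑Y with X? [] | Y? []
... | yes XA | no ¬YA = contradiction (X⊑Y [] XA) ¬YA
... | yes _  | yes _  = ≤-refl
... | no _   | _      = z≤n
count-mono {n = suc n} X? Y? X⊑Y =
  +-mono-≤ (count-mono (λ A → X? (inside ∷ A))  (λ A → Y? (inside ∷ A))  (λ A → X⊑Y (inside ∷ A)))
           (count-mono (λ A → X? (outside ∷ A)) (λ A → Y? (outside ∷ A)) (λ A → X⊑Y (outside ∷ A)))

count-strict : ∀ {n} {X Y : Family n} (X? : DecFamily X) (Y? : DecFamily Y) → X ⊑ Y →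
               (A : Subset n) → Y A → ¬ X A → count X? < count Y?
count-strict {n = zero} X? Y? X⊑Y [] YA ¬XA with X? [] | Y? []
... | yes XA | _      = contradiction XA ¬XA
... | no _   | yes _  = s≤s z≤n
... | no _   | no ¬YA = contradiction YA ¬YA
count-strict {n = suc n} X? Y? X⊑Y (inside ∷ A) YA ¬XA =
  +-mono-<-≤ (count-strict (λ A → X? (inside ∷ A)) (λ A → Y? (inside ∷ A)) (λ A → X⊑Y (inside ∷ A)) A YA ¬XA)
             (count-mono (λ A → X? (outside ∷ A)) (λ A → Y? (outside ∷ A)) (λ A → X⊑Y (outside ∷ A)))
count-strict {n = suc n} X? Y? X⊑Y (outside ∷ A) YA ¬XA =
  +-mono-≤-< (count-mono (λ A → X? (inside ∷ A)) (λ A → Y? (inside ∷ A)) (λ A → X⊑Y (inside ∷ A)))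
             (count-strict (λ A → X? (outside ∷ A)) (λ A → Y? (outside ∷ A)) (λ A → X⊑Y (outside ∷ A)) A YA ¬XA)

module Chain (F : ℕ → Family n) (F? : ∀ i → DecFamily (F i)) (F-step : ∀ i → F i ⊑ F (suc i)) where

  mono : ∀ {i j} → i ≤ j → F i ⊑ F j
  mono i≤j = mono′ (≤⇒≤′ i≤j)
    where
    mono′ : ∀ {i j} → i ≤′ j → F i ⊑ F j
    mono′ ≤′-refl       A Fᵢ = Fᵢ
    mono′ (≤′-step i≤j) A Fᵢ = F-step _ A (mono′ i≤j A Fᵢ)

  grows-or-stops : ∀ i → i ≤ count (F? i) ⊎ ∃ λ k → F (suc k) ⊑ F k
  grows-or-stops zero = inj₁ z≤n
  grows-or-stops (suc i) with grows-or-stops i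
  ... | inj₂ stop = inj₂ stop
  ... | inj₁ i≤count with anySubset? (λ A → F? (suc i) A ×-dec ¬? (F? i A))
  ...   | yes (A , Fₛᵢ , ¬Fᵢ) =
    inj₁ (≤-trans (s≤s i≤count) (count-strict (F? i) (F? (suc i)) (F-step i) A Fₛᵢ ¬Fᵢ))
  ...   | no none = inj₂ (i , λ A Fₛᵢ → decidable-stable (F? i A) (λ ¬Fᵢ → none (A , Fₛᵢ , ¬Fᵢ)))

  stabilises : ∃ λ k → F (suc k) ⊑ F k
  stabilises with grows-or-stops (suc (2 ^ n))
  ... | inj₂ stop = stop
  ... | inj₁ big  = contradiction (≤-trans big (count≤2^n (F? (suc (2 ^ n))))) (n≮n _)

minF-isSimple : (X : Family n) → IsSimple (minF X)
minF-isSimple X A B (XA , _) (_ , minB) A≢B A⊆B = minB A XA (p⊆q∧p≢q⇒p⊂q A⊆B A≢B)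

minF-isMatroid : DecFamily X → ε X ⊑ X → IsMatroid (minF X)
minF-isMatroid {n} {X} X? εX⊑X = minF-isSimple X , eliminate
  where
  eliminate : (C₁ C₂ : Subset n) → minF X C₁ → minF X C₂ → C₁ ≢ C₂ → (v : Fin n) → v ∈ C₁ ∩ C₂ →
              ∃ λ C₃ → minF X C₃ × C₃ ⊆ (C₁ ∪ C₂) - v
  eliminate C₁ C₂ (XC₁ , minC₁) (XC₂ , minC₂) C₁≢C₂ v v∈ =
    minF-below X? _ (εX⊑X _ (inj₂ (C₁ , C₂ , v , XC₁ , XC₂ , ¬X∩ , v∈ , refl)))
    where
    ¬X∩ : ¬ X (C₁ ∩ C₂)
    ¬X∩ X∩ with (C₁ ∩ C₂) ≟ˢ C₁
    ... | no ∩≢C₁ = minC₁ _ X∩ (p⊆q∧p≢q⇒p⊂q (p∩q⊆p C₁ C₂) ∩≢C₁)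
    ... | yes ∩≡C₁ = minC₂ C₁ XC₁ (p⊆q∧p≢q⇒p⊂q C₁⊆C₂ C₁≢C₂)
      where
      C₁⊆C₂ : C₁ ⊆ C₂
      C₁⊆C₂ h = p∩q⊆q C₁ C₂ (subst (_ ∈_) (sym ∩≡C₁) h)

isMatroid-resp : ∀ {n} {X Y : Family n} → IsMatroid X → X ≐ Y → IsMatroid Y
isMatroid-resp {n} {X} {Y} (simple , eliminate) X≐Y = simple′ , eliminate′
  where
  from : Y ⊑ X
  from A = Equivalence.from (X≐Y A)
  simple′ : IsSimple Y
  simple′ A B YA YB = simple A B (from A YA) (from B YB)
  eliminate′ : (C₁ C₂ : Subset n) → Y C₁ → Y C₂ → C₁ ≢ C₂ → (v : Fin n) → v ∈ C₁ ∩ C₂ →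
               ∃ λ C₃ → Y C₃ × C₃ ⊆ (C₁ ∪ C₂) - v
  eliminate′ C₁ C₂ YC₁ YC₂ C₁≢C₂ v v∈
    with eliminate C₁ C₂ (from C₁ YC₁) (from C₂ YC₂) C₁≢C₂ v v∈
  ... | C₃ , XC₃ , C₃⊆ = C₃ , Equivalence.to (X≐Y C₃) XC₃ , C₃⊆

module Closure (ℰ : Family n) (ℰ? : DecFamily ℰ) where

  private
    E = Eseq ℰ
    F = Fseq ℰ

  E? : ∀ i → DecFamily (E i)
  E? zero    = ℰ?
  E? (suc i) = minF-dec (ε-dec (E? i))

  F? : ∀ i → DecFamily (F i)
  F? zero    = ℰ?
  F? (suc i) = up-dec (ε-dec (F? i))

  between-E-F : ∀ i → Between (E i) (F i)
  between-E-F zero          = between-refl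
  between-E-F (suc zero)    = between-minF-up (ε-dec ℰ?) between-refl
  between-E-F (suc (suc i)) = between-minF-up (ε-dec (E? (suc i)))
    (between-ε (minF-antichain _) (up-upwardClosed _) (between-E-F (suc i)))

  minF-Fam≐E' : minF (Fam ℰ) ≐ E' ℰ
  minF-Fam≐E' = between⇒minF≐
    ((λ A (i , Eᵢ) → i , proj₁ (between-E-F i) A Eᵢ) ,
     (λ A (i , Fᵢ) → let B , Eᵢ , B⊆A = proj₂ (between-E-F i) A Fᵢ in B , (i , Eᵢ) , B⊆A))

  F-step : ∀ i → F i ⊑ F (suc i)
  F-step i A Fᵢ = A , inj₁ Fᵢ , ⊆-refl

  open Chain F F? F-step using (mono; stabilises)

  Fam-ε-closed : ε (Fam ℰ) ⊑ Fam ℰ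
  Fam-ε-closed A (inj₁ FamA) = FamA
  Fam-ε-closed A (inj₂ (A₁ , A₂ , v , (i , Fᵢ) , (j , Fⱼ) , ¬Fam∩ , v∈ , A≡)) =
    suc k , A , inj₂ (A₁ , A₂ , v , mono (m≤m⊔n i j) A₁ Fᵢ , mono (m≤n⊔m i j) A₂ Fⱼ ,
                      (λ Fₖ → ¬Fam∩ (k , Fₖ)) , v∈ , A≡) , ⊆-refl
    where
    k = i ⊔ j

  K : ℕ
  K = proj₁ stabilises

  -- ε only respects extensional equality, so each step needs both inclusions.
  stable-from-K : ∀ m → F (m + K) ⊑ F K
  stable-from-K zero    = ⊑-refl
  stable-from-K (suc m) A Fₘ₊ₖ₊₁ =
    proj₂ stabilises A (up-mono (ε-resp (stable-from-K m) (mono (m≤n+m K m))) A Fₘ₊ₖ₊₁)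

  F⊑F-K : ∀ j → F j ⊑ F K
  F⊑F-K j A Fⱼ = stable-from-K j A (mono (m≤m+n j K) A Fⱼ)

  Fam-dec : DecFamily (Fam ℰ)
  Fam-dec A with F? K A
  ... | yes Fₖ = yes (K , Fₖ)
  ... | no ¬Fₖ = no (λ (j , Fⱼ) → ¬Fₖ (F⊑F-K j A Fⱼ))

mainTheorem2 : (n : ℕ) (ℰ : List (Subset n)) →
    (minF (Fam (edgesOf ℰ)) ≐ E' (edgesOf ℰ)) × IsMatroid (E' (edgesOf ℰ))
mainTheorem2 n ℰ =
  minF-Fam≐E' , isMatroid-resp (minF-isMatroid Fam-dec Fam-ε-closed) minF-Fam≐E'
  where open Closure (edgesOf ℰ) (edgesOf-dec ℰ)
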